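{- Let $a,b,d$ be three pairwise coprime positive integers such that $d\notin\langle a,b\rangle$ and $d\geqslant 2$. There exist $\alpha'\in\frac1b\mathbb{Z}$ and $\alpha\in\frac1a\mathbb{Z}$ with $\alpha'-\alpha=\frac{d}{ab}$, and for any such $\alpha,\alpha'$, the multiplicity $m(\langle a,b\rangle/d)$ equals the denominator (in reduced form) of the best rational in $[\alpha,\alpha']$, i.e. the smallest positive integer $q$ such that $[\alpha,\alpha']$ contains a rational number of the form $p/q$ with $p\in\mathbb{Z}$.
   Context: $\langle a,b\rangle=\{xa+yb:x,y\in\mathbb{N}\}$. For a numerical semigroup $S\subseteq\mathbb{N}$ and a positive integer $d$, $S/d=\{x\in\mathbb{N}:dx\in S\}$. The multiplicity $m(S)$ of a numerical semigroup $S$ is its smallest positive element. The best rational in an interval is the rational in it whose reduced denominator is minimal. -}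

module Defs where

open import Data.Nat as ℕ using (ℕ; zero; suc; _≤_; _<_; NonZero)
open import Data.Nat.Properties using (m*n≢0)
open import Data.Integer as ℤ using (ℤ; +_)
open import Data.Rational as ℚ using (ℚ; _/_)
open import Data.Product using (∃; ∃₂; _×_)
open import Data.Empty using (⊥)
open import Relation.Binary.PropositionalEquality using (_≡_)

_∈⟨_,_⟩ : ℕ → ℕ → ℕ → Set
n ∈⟨ a , b ⟩ = ∃₂ λ x y → n ≡ x ℕ.* a ℕ.+ y ℕ.* b

_∈⟨_,_⟩/_ : ℕ → ℕ → ℕ → ℕ → Set
x ∈⟨ a , b ⟩/ d = (d ℕ.* x) ∈⟨ a , b ⟩

IsLeastPositive : (ℕ → Set) → ℕ → Set
IsLeastPositive P m = 0 < m × P m × (∀ k → 0 < k → P k → m ≤ k)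

IsMultiplicityQuot : ℕ → ℕ → ℕ → ℕ → Set
IsMultiplicityQuot a b d m = IsLeastPositive (λ x → x ∈⟨ a , b ⟩/ d) m

_∈ℤ/_ : ℚ → (a : ℕ) → .{{NonZero a}} → Set
α ∈ℤ/ a = ∃ λ (v : ℤ) → α ≡ v / a

d/ab : (d a b : ℕ) → .{{NonZero a}} → .{{NonZero b}} → ℚ
d/ab d a b = _/_ (+ d) (a ℕ.* b) {{m*n≢0 a b}}

ContainsFracWithDen : ℚ → ℚ → ℕ → Set
ContainsFracWithDen α α' zero = ⊥
ContainsFracWithDen α α' (suc n) =
  ∃ λ (p : ℤ) → α ℚ.≤ (p / suc n) × (p / suc n) ℚ.≤ α'

IsBestDenominator : ℚ → ℚ → ℕ → Set
IsBestDenominator α α' q = IsLeastPositive (ContainsFracWithDen α α') q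

-- Write α = u/a and α' = v/b, so that va − ub = d.  For x > 0, a representation
-- dx = x'a + y'b gives (vx − x')a = (ux + y')b, hence by coprimality vx − x' = pb and
-- ux + y' = pa for some integer p, i.e. u/a ≤ p/x ≤ v/b; conversely such a p yields
-- the representation x' = vx − pb, y' = pa − ux.  So the positive elements of
-- ⟨a,b⟩/d are exactly the denominators of fractions in [α,α'], and the two sets
-- have the same least element.
module Submission where

open import Defs
open import Data.Nat using (ℕ; _≤_; NonZero)
open import Data.Nat.Coprimality using (Coprime)
open import Data.Rational using (ℚ; _-_)
open import Data.Product using (∃; ∃₂; _×_)
open import Relation.Nullary using (¬_)
open import Relation.Binary.PropositionalEquality using (_≡_)

open import Data.Nat as ℕ using (zero; suc; _<_; _<?_)
import Data.Nat.Properties as ℕ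
open import Data.Nat.Induction using (<-rec)
import Data.Nat.Coprimality as ℕ
open import Data.Nat.GCD using (module Bézout)
open import Data.Integer as ℤ using (ℤ; +_; 0ℤ; 1ℤ)
import Data.Integer.Properties as ℤ
import Data.Integer.Divisibility.Signed as ℤ
open import Data.Integer.Coprimality using (coprime-divisor)
open import Algebra.Properties.CommutativeSemigroup ℤ.*-commutativeSemigroup using (xy∙z≈xz∙y)
open import Data.Integer.Tactic.RingSolver using (solve-∀)
open import Data.Rational as ℚ using (_/_; toℚᵘ)
import Data.Rational.Properties as ℚ
open import Data.Rational.Unnormalised as ℚᵘ using (mkℚᵘ; *≡*; *≤*)
import Data.Rational.Unnormalised.Properties as ℚᵘ
open import Data.Product using (_,_; proj₁; proj₂)
open import Data.Empty using (⊥-elim-irr)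
open import Function.Bundles using (_⇔_; mk⇔; Equivalence)
open import Relation.Nullary using (yes; no; map′; _×-dec_)
open import Relation.Unary using (Decidable)
open import Relation.Binary.PropositionalEquality using (refl; sym; trans; cong; cong₂; module ≡-Reasoning)

toℚᵘ-/ : ∀ i k → toℚᵘ (i / suc k) ℚᵘ.≃ mkℚᵘ i k
toℚᵘ-/ i k = ℚ.toℚᵘ-fromℚᵘ (mkℚᵘ i k)

/≤/⇔ : ∀ i j m n → (i / suc m ℚ.≤ j / suc n) ⇔ (i ℤ.* + suc n ℤ.≤ j ℤ.* + suc m)
/≤/⇔ i j m n = mk⇔
  (λ i/m≤j/n → unwrap
    (ℚᵘ.≤-respʳ-≃ (toℚᵘ-/ j n) (ℚᵘ.≤-respˡ-≃ (toℚᵘ-/ i m) (ℚ.toℚᵘ-mono-≤ i/m≤j/n))))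
  (λ in≤jm → ℚ.toℚᵘ-cancel-≤
    (ℚᵘ.≤-respʳ-≃ (ℚᵘ.≃-sym (toℚᵘ-/ j n)) (ℚᵘ.≤-respˡ-≃ (ℚᵘ.≃-sym (toℚᵘ-/ i m)) (*≤* in≤jm))))
  where
  unwrap : mkℚᵘ i m ℚᵘ.≤ mkℚᵘ j n → i ℤ.* + suc n ℤ.≤ j ℤ.* + suc m
  unwrap (*≤* in≤jm) = in≤jm

/-injectiveˡ : ∀ {i j} k → i / suc k ≡ j / suc k → i ≡ j
/-injectiveˡ {i} {j} k i/k≡j/k with ℚᵘ.≃-trans (ℚᵘ.≃-sym (toℚᵘ-/ i k))
                                      (ℚᵘ.≃-trans (ℚ.toℚᵘ-cong i/k≡j/k) (toℚᵘ-/ j k))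
... | *≡* ik≡jk = ℤ.*-cancelʳ-≡ i j (+ suc k) ik≡jk

v/n-u/m≡[vm-un]/mn : ∀ u v m n →
  v / suc n ℚ.- u / suc m ≡ (v ℤ.* + suc m ℤ.- u ℤ.* + suc n) / (suc m ℕ.* suc n)
v/n-u/m≡[vm-un]/mn u v m n = ℚ.toℚᵘ-injective (ℚᵘ.≃-trans
  (ℚᵘ.≃-trans (ℚ.toℚᵘ-homo-+ (v / suc n) (ℚ.- (u / suc m)))
    (ℚᵘ.+-cong (toℚᵘ-/ v n) (ℚᵘ.≃-trans (ℚ.toℚᵘ-homo‿- (u / suc m)) (ℚᵘ.-‿cong (toℚᵘ-/ u m)))))
  (ℚᵘ.≃-trans (*≡* cross) (ℚᵘ.≃-sym (toℚᵘ-/ (v ℤ.* + suc m ℤ.- u ℤ.* + suc n) (n ℕ.+ m ℕ.* suc n)))))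
  where
  cross : (v ℤ.* + suc m ℤ.+ (ℤ.- u) ℤ.* + suc n) ℤ.* + (suc m ℕ.* suc n)
        ≡ (v ℤ.* + suc m ℤ.- u ℤ.* + suc n) ℤ.* + (suc n ℕ.* suc m)
  cross = cong₂ ℤ._*_ (cong (ℤ._+_ (v ℤ.* + suc m)) (sym (ℤ.neg-distribˡ-* u (+ suc n))))
                      (cong +_ (ℕ.*-comm (suc m) (suc n)))

v/n-u/m≡d/mn⇔vm-un≡d : ∀ u v m n d →
  (v / suc n ℚ.- u / suc m ≡ d/ab d (suc m) (suc n)) ⇔ (v ℤ.* + suc m ℤ.- u ℤ.* + suc n ≡ + d)
v/n-u/m≡d/mn⇔vm-un≡d u v m n d = mk⇔
  (λ α'-α≡d/ab → /-injectiveˡ (n ℕ.+ m ℕ.* suc n)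
                   (trans (sym (v/n-u/m≡[vm-un]/mn u v m n)) α'-α≡d/ab))
  (λ vm-un≡d → trans (v/n-u/m≡[vm-un]/mn u v m n) (cong (λ i → i / (suc m ℕ.* suc n)) vm-un≡d))

pos-*+* : ∀ x a y b → + (x ℕ.* a ℕ.+ y ℕ.* b) ≡ + x ℤ.* + a ℤ.+ + y ℤ.* + b
pos-*+* x a y b = trans (ℤ.pos-+ (x ℕ.* a) (y ℕ.* b)) (cong₂ ℤ._+_ (ℤ.pos-* x a) (ℤ.pos-* y b))

i+j≡k⇒k-j≡i : ∀ {i j k} → i ℤ.+ j ≡ k → k ℤ.- j ≡ i
i+j≡k⇒k-j≡i {i} {j} refl = i+j-j≡i i j
  where
  i+j-j≡i : ∀ i j → i ℤ.+ j ℤ.- j ≡ i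
  i+j-j≡i = solve-∀

1+yb≡xa⇒xa-yb≡1 : ∀ {x a y b} → 1 ℕ.+ y ℕ.* b ≡ x ℕ.* a → + x ℤ.* + a ℤ.- + y ℤ.* + b ≡ 1ℤ
1+yb≡xa⇒xa-yb≡1 {x} {a} {y} {b} e = i+j≡k⇒k-j≡i (begin
  1ℤ ℤ.+ + y ℤ.* + b   ≡⟨ pos-*+* 1 1 y b ⟨
  + (1 ℕ.+ y ℕ.* b)    ≡⟨ cong +_ e ⟩
  + (x ℕ.* a)          ≡⟨ ℤ.pos-* x a ⟩
  + x ℤ.* + a          ∎)
  where open ≡-Reasoning

coprime⇒∃-combination≡1 : ∀ {a b} → Coprime a b → ∃₂ λ s t → s ℤ.* + a ℤ.- t ℤ.* + b ≡ 1ℤ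
coprime⇒∃-combination≡1 {a} {b} a⊥b with ℕ.coprime-Bézout a⊥b
... | Bézout.+- x y 1+yb≡xa = + x , + y , 1+yb≡xa⇒xa-yb≡1 {x} {a} {y} {b} 1+yb≡xa
... | Bézout.-+ x y 1+xa≡yb = ℤ.- + x , ℤ.- + y ,
  trans (swap (+ x) (+ a) (+ y) (+ b)) (1+yb≡xa⇒xa-yb≡1 {y} {b} {x} {a} 1+xa≡yb)
  where
  swap : ∀ s a t b → (ℤ.- s) ℤ.* a ℤ.- (ℤ.- t) ℤ.* b ≡ t ℤ.* b ℤ.- s ℤ.* a
  swap = solve-∀

coprime⇒∃-combination≡ : ∀ {a b} → Coprime a b → ∀ d → ∃₂ λ u v → v ℤ.* + a ℤ.- u ℤ.* + b ≡ + d
coprime⇒∃-combination≡ {a} {b} a⊥b d with coprime⇒∃-combination≡1 a⊥b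
... | s , t , sa-tb≡1 = + d ℤ.* t , + d ℤ.* s , (begin
  (+ d ℤ.* s) ℤ.* + a ℤ.- (+ d ℤ.* t) ℤ.* + b  ≡⟨ factor (+ d) s t (+ a) (+ b) ⟩
  + d ℤ.* (s ℤ.* + a ℤ.- t ℤ.* + b)            ≡⟨ cong (+ d ℤ.*_) sa-tb≡1 ⟩
  + d ℤ.* 1ℤ                                   ≡⟨ ℤ.*-identityʳ (+ d) ⟩
  + d                                          ∎)
  where
  open ≡-Reasoning
  factor : ∀ d s t a b → (d ℤ.* s) ℤ.* a ℤ.- (d ℤ.* t) ℤ.* b ≡ d ℤ.* (s ℤ.* a ℤ.- t ℤ.* b)
  factor = solve-∀

∈⟨,⟩? : ∀ a b .{{_ : NonZero a}} .{{_ : NonZero b}} → Decidable (λ n → n ∈⟨ a , b ⟩)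
∈⟨,⟩? a b n = map′ from to
  (ℕ.anyUpTo? (λ x → ℕ.anyUpTo? (λ y → n ℕ.≟ x ℕ.* a ℕ.+ y ℕ.* b) (suc n)) (suc n))
  where
  Bounded : Set
  Bounded = ∃ λ x → x < suc n × ∃ λ y → y < suc n × n ≡ x ℕ.* a ℕ.+ y ℕ.* b
  from : Bounded → n ∈⟨ a , b ⟩
  from (x , _ , y , _ , n≡xa+yb) = x , y , n≡xa+yb
  to : n ∈⟨ a , b ⟩ → Bounded
  to (x , y , refl) =
    x , ℕ.s≤s (ℕ.≤-trans (ℕ.m≤m*n x a) (ℕ.m≤m+n (x ℕ.* a) (y ℕ.* b))) ,
    y , ℕ.s≤s (ℕ.≤-trans (ℕ.m≤m*n y b) (ℕ.m≤n+m (y ℕ.* b) (x ℕ.* a))) , refl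

FractionBetween : ℤ → ℕ → ℤ → ℕ → ℕ → Set
FractionBetween u a v b x = ∃ λ p → u ℤ.* + x ℤ.≤ p ℤ.* + a × p ℤ.* + b ℤ.≤ v ℤ.* + x

ContainsFracWithDen⇔FractionBetween : ∀ u v m n k →
  ContainsFracWithDen (u / suc m) (v / suc n) (suc k) ⇔ FractionBetween u (suc m) v (suc n) (suc k)
ContainsFracWithDen⇔FractionBetween u v m n k = mk⇔
  (λ (p , α≤p/k , p/k≤α') → p , to (/≤/⇔ u p m k) α≤p/k , to (/≤/⇔ p v k n) p/k≤α')
  (λ (p , ux≤pa , pb≤vx) → p , from (/≤/⇔ u p m k) ux≤pa , from (/≤/⇔ p v k n) pb≤vx)
  where open Equivalence

module _ {a b d : ℕ} .{{_ : NonZero b}} (a⊥b : Coprime a b) {u v : ℤ}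
         (va-ub≡d : v ℤ.* + a ℤ.- u ℤ.* + b ≡ + d) where

  ∈⟨,⟩/⇒FractionBetween : ∀ x → x ∈⟨ a , b ⟩/ d → FractionBetween u a v b x
  ∈⟨,⟩/⇒FractionBetween x (x' , y' , dx≡x'a+y'b) = p , ux≤pa , pb≤vx
    where
    open ≡-Reasoning
    balance : (v ℤ.* + x ℤ.- + x') ℤ.* + a ≡ (u ℤ.* + x ℤ.+ + y') ℤ.* + b
    balance = ℤ.i-j≡0⇒i≡j ((v ℤ.* + x ℤ.- + x') ℤ.* + a) ((u ℤ.* + x ℤ.+ + y') ℤ.* + b) (begin
      (v ℤ.* + x ℤ.- + x') ℤ.* + a ℤ.- (u ℤ.* + x ℤ.+ + y') ℤ.* + b
        ≡⟨ regroup v u (+ x) (+ a) (+ b) (+ x') (+ y') ⟩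
      (v ℤ.* + a ℤ.- u ℤ.* + b) ℤ.* + x ℤ.- (+ x' ℤ.* + a ℤ.+ + y' ℤ.* + b)
        ≡⟨ cong (λ c → c ℤ.* + x ℤ.- (+ x' ℤ.* + a ℤ.+ + y' ℤ.* + b)) va-ub≡d ⟩
      + d ℤ.* + x ℤ.- (+ x' ℤ.* + a ℤ.+ + y' ℤ.* + b)
        ≡⟨ ℤ.i≡j⇒i-j≡0 (trans (sym (ℤ.pos-* d x)) (trans (cong +_ dx≡x'a+y'b) (pos-*+* x' a y' b))) ⟩
      0ℤ ∎)
      where
      regroup : ∀ v u x a b x' y' →
        (v ℤ.* x ℤ.- x') ℤ.* a ℤ.- (u ℤ.* x ℤ.+ y') ℤ.* b ≡
        (v ℤ.* a ℤ.- u ℤ.* b) ℤ.* x ℤ.- (x' ℤ.* a ℤ.+ y' ℤ.* b)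
      regroup = solve-∀
    b∣vx-x' : + b ℤ.∣ v ℤ.* + x ℤ.- + x'
    b∣vx-x' = ℤ.∣ᵤ⇒∣ (coprime-divisor (+ b) (+ a) (v ℤ.* + x ℤ.- + x') (ℕ.sym a⊥b)
      (ℤ.∣⇒∣ᵤ (ℤ.divides (u ℤ.* + x ℤ.+ + y') (trans (ℤ.*-comm (+ a) (v ℤ.* + x ℤ.- + x')) balance))))
    p : ℤ
    p = ℤ._∣_.quotient b∣vx-x'
    vx-x'≡pb : v ℤ.* + x ℤ.- + x' ≡ p ℤ.* + b
    vx-x'≡pb = ℤ._∣_.equality b∣vx-x'
    pa≡ux+y' : p ℤ.* + a ≡ u ℤ.* + x ℤ.+ + y'
    pa≡ux+y' = ℤ.*-cancelʳ-≡ (p ℤ.* + a) (u ℤ.* + x ℤ.+ + y') (+ b) (begin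
      p ℤ.* + a ℤ.* + b             ≡⟨ xy∙z≈xz∙y p (+ a) (+ b) ⟩
      p ℤ.* + b ℤ.* + a             ≡⟨ cong (ℤ._* + a) vx-x'≡pb ⟨
      (v ℤ.* + x ℤ.- + x') ℤ.* + a  ≡⟨ balance ⟩
      (u ℤ.* + x ℤ.+ + y') ℤ.* + b  ∎)
    pb≤vx : p ℤ.* + b ℤ.≤ v ℤ.* + x
    pb≤vx = ℤ.≤-trans (ℤ.≤-reflexive (sym vx-x'≡pb)) (ℤ.i-j≤i (v ℤ.* + x) (+ x'))
    ux≤pa : u ℤ.* + x ℤ.≤ p ℤ.* + a
    ux≤pa = ℤ.≤-trans (ℤ.i≤i+j (u ℤ.* + x) (+ y')) (ℤ.≤-reflexive (sym pa≡ux+y'))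

  FractionBetween⇒∈⟨,⟩/ : ∀ x → FractionBetween u a v b x → x ∈⟨ a , b ⟩/ d
  FractionBetween⇒∈⟨,⟩/ x (p , ux≤pa , pb≤vx) = ℤ.∣ vx-pb ∣ , ℤ.∣ pa-ux ∣ , ℤ.+-injective (begin
    + (d ℕ.* x)                                  ≡⟨ ℤ.pos-* d x ⟩
    + d ℤ.* + x                                  ≡⟨ cong (ℤ._* + x) va-ub≡d ⟨
    (v ℤ.* + a ℤ.- u ℤ.* + b) ℤ.* + x            ≡⟨ regroup v u p (+ x) (+ a) (+ b) ⟩
    vx-pb ℤ.* + a ℤ.+ pa-ux ℤ.* + b              ≡⟨ cong₂ (λ s t → s ℤ.* + a ℤ.+ t ℤ.* + b)
                                                      (ℤ.0≤i⇒+∣i∣≡i (ℤ.i≤j⇒0≤j-i pb≤vx))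
                                                      (ℤ.0≤i⇒+∣i∣≡i (ℤ.i≤j⇒0≤j-i ux≤pa)) ⟨
    + ℤ.∣ vx-pb ∣ ℤ.* + a ℤ.+ + ℤ.∣ pa-ux ∣ ℤ.* + b ≡⟨ pos-*+* ℤ.∣ vx-pb ∣ a ℤ.∣ pa-ux ∣ b ⟨
    + (ℤ.∣ vx-pb ∣ ℕ.* a ℕ.+ ℤ.∣ pa-ux ∣ ℕ.* b)  ∎)
    where
    open ≡-Reasoning
    vx-pb pa-ux : ℤ
    vx-pb = v ℤ.* + x ℤ.- p ℤ.* + b
    pa-ux = p ℤ.* + a ℤ.- u ℤ.* + x
    regroup : ∀ v u p x a b →
      (v ℤ.* a ℤ.- u ℤ.* b) ℤ.* x ≡ (v ℤ.* x ℤ.- p ℤ.* b) ℤ.* a ℤ.+ (p ℤ.* a ℤ.- u ℤ.* x) ℤ.* b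
    regroup = solve-∀

leastPositive : {P : ℕ → Set} → Decidable P → ∀ {w} → 0 < w → P w → ∃ (IsLeastPositive P)
leastPositive {P} P? {w} = <-rec Goal search w
  where
  Goal : ℕ → Set
  Goal w = 0 < w → P w → ∃ (IsLeastPositive P)
  search : ∀ w → (∀ {k} → k < w → Goal k) → Goal w
  search w below 0<w Pw with ℕ.anyUpTo? (λ k → 0 <? k ×-dec P? k) w
  ... | yes (k , k<w , 0<k , Pk) = below k<w 0<k Pk
  ... | no ∄k = w , 0<w , Pw , λ k 0<k Pk → ℕ.≮⇒≥ λ k<w → ∄k (k , k<w , 0<k , Pk)

IsLeastPositive-resp-⇔ : ∀ {P Q : ℕ → Set} {m} → (∀ k → 0 < k → P k ⇔ Q k) →
  IsLeastPositive P m → IsLeastPositive Q m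
IsLeastPositive-resp-⇔ P⇔Q (0<m , Pm , minimal) =
  0<m , to (P⇔Q _ 0<m) Pm , λ k 0<k Qk → minimal k 0<k (from (P⇔Q k 0<k) Qk)
  where open Equivalence

multiplicity≡bestDenominator : ∀ {m n d} → Coprime (suc m) (suc n) → ∀ u v →
  v / suc n - u / suc m ≡ d/ab d (suc m) (suc n) →
  ∃ λ q → IsMultiplicityQuot (suc m) (suc n) d q × IsBestDenominator (u / suc m) (v / suc n) q
multiplicity≡bestDenominator {m} {n} {d} a⊥b u v α'-α≡d/ab =
  q , q-least , IsLeastPositive-resp-⇔ quotient⇔fraction q-least
  where
  open Equivalence
  va-ub≡d : v ℤ.* + suc m ℤ.- u ℤ.* + suc n ≡ + d
  va-ub≡d = to (v/n-u/m≡d/mn⇔vm-un≡d u v m n d) α'-α≡d/ab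
  multiplicity : ∃ (IsMultiplicityQuot (suc m) (suc n) d)
  multiplicity = leastPositive (λ x → ∈⟨,⟩? (suc m) (suc n) (d ℕ.* x)) (ℕ.s≤s ℕ.z≤n)
                   (d , 0 , sym (ℕ.+-identityʳ (d ℕ.* suc m)))
  q = proj₁ multiplicity
  q-least = proj₂ multiplicity
  quotient⇔fraction : ∀ k → 0 < k →
    k ∈⟨ suc m , suc n ⟩/ d ⇔ ContainsFracWithDen (u / suc m) (v / suc n) k
  quotient⇔fraction (suc k) _ = mk⇔
    (λ dk∈ → from (ContainsFracWithDen⇔FractionBetween u v m n k)
               (∈⟨,⟩/⇒FractionBetween a⊥b {u} {v} va-ub≡d (suc k) dk∈))
    (λ frac → FractionBetween⇒∈⟨,⟩/ a⊥b {u} {v} va-ub≡d (suc k)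
                (to (ContainsFracWithDen⇔FractionBetween u v m n k) frac))

theorem4 : (a b d : ℕ) → .{{_ : NonZero a}} → .{{_ : NonZero b}} →
    Coprime a b → Coprime a d → Coprime b d →
    ¬ (d ∈⟨ a , b ⟩) → 2 ≤ d →
    (∃₂ λ (α α' : ℚ) → α' ∈ℤ/ b × α ∈ℤ/ a × α' - α ≡ d/ab d a b)
    × (∀ (α α' : ℚ) → α' ∈ℤ/ b → α ∈ℤ/ a → α' - α ≡ d/ab d a b →
    ∃ λ (q : ℕ) → IsMultiplicityQuot a b d q × IsBestDenominator α α' q)
theorem4 zero _ _ {{a≢0}} = ⊥-elim-irr (ℕ.NonZero.nonZero a≢0)
theorem4 (suc _) zero _ {{_}} {{b≢0}} = ⊥-elim-irr (ℕ.NonZero.nonZero b≢0)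
theorem4 (suc m) (suc n) d a⊥b _ _ _ _ = existence , λ
  { .(u / suc m) .(v / suc n) (v , refl) (u , refl) α'-α≡d/ab →
      multiplicity≡bestDenominator {m} {n} {d} a⊥b u v α'-α≡d/ab }
  where
  open Equivalence
  existence : ∃₂ λ α α' → α' ∈ℤ/ suc n × α ∈ℤ/ suc m × α' - α ≡ d/ab d (suc m) (suc n)
  existence = let (u , v , va-ub≡d) = coprime⇒∃-combination≡ {suc m} {suc n} a⊥b d in
    u / suc m , v / suc n , (v , refl) , (u , refl) , from (v/n-u/m≡d/mn⇔vm-un≡d u v m n d) va-ub≡d
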